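{- For integers $p,q\ge1$, \[ S^{(r)}_{[\,p+1\,|\,q\,]}(X)\,S^{(r-1)}_{[\,p-1\,|\,q\,]}(X)=S^{(r)}_{[\,p\,|\,q\,]}(X)\,S^{(r-1)}_{[\,p\,|\,q\,]}(X)-S^{(r)}_{[\,p\,|\,q-1\,]}(X)\,S^{(r-1)}_{[\,p\,|\,q+1\,]}(X). \]
   Context: $[\,m\,|\,n\,]$ denotes the rectangular partition $(n^m)$ ($m$ rows of length $n$); it is the empty partition if $m=0$ or $n=0$. Let $N$ be a positive integer and $X=[x_{i,j}]_{1\le i,j\le N}$ a matrix of indeterminates. Over $\mathbb{C}(X)$ write the Gauss decomposition $X=X_-X_0X_+$ ($X_-$ lower unitriangular, $X_0$ diagonal, $X_+$ upper unitriangular). For $0\le r\le N$ and a partition $\lambda$ contained in $((N-r)^r)$, let $J=\{\lambda_{r+1-a}+a:1\le a\le r\}$ and let $S^{(r)}_{\lambda}(X)$ be the minor of $X_+$ with row set $\{1,\ldots,r\}$ and column set $J$ (so $S^{(r)}_\varnothing=1$). $N$ is assumed large enough that all quantities appearing are defined. -}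

module Defs where

open import Level using (Level)
open import Data.Nat using (ℕ; zero; suc; _∸_; _<?_; _≤ᵇ_) renaming (_+_ to _+ℕ_; _<_ to _<ℕ_)
open import Data.Product using (_×_)
open import Data.Bool using (if_then_else_)
open import Data.Fin using (Fin; zero; suc; toℕ; fromℕ<; punchIn)
open import Relation.Nullary using (yes; no; ¬_)
open import Relation.Binary.PropositionalEquality using (_≡_)
open import Algebra.Bundles using (CommutativeRing)

-- A partition is encoded as the function i ↦ λ_i (1-indexed, λ_0 unused).
Partition : Set
Partition = ℕ → ℕ

rect : ℕ → ℕ → Partition
rect m n zero    = 0
rect m n (suc i) = if suc i ≤ᵇ m then n else 0

module _ {c ℓ : Level} (R : CommutativeRing c ℓ) where
  open CommutativeRing R using (Carrier; _≈_; _+_; _*_; -_; 0#; 1#)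

  Mat : ℕ → Set c
  Mat N = Fin N → Fin N → Carrier

  sumF : (n : ℕ) → (Fin n → Carrier) → Carrier
  sumF zero    f = 0#
  sumF (suc n) f = f zero + sumF n (λ j → f (suc j))

  sgn : ℕ → Carrier
  sgn zero    = 1#
  sgn (suc k) = - sgn k

  det : (n : ℕ) → (Fin n → Fin n → Carrier) → Carrier
  det zero    M = 1#
  det (suc n) M =
    sumF (suc n) (λ j → sgn (toℕ j) * M zero j * det n (λ a b → M (suc a) (punchIn j b)))

  _⊗_ : {N : ℕ} → Mat N → Mat N → Mat N
  (A ⊗ B) i k = sumF _ (λ j → A i j * B j k)

  IsLowerUnitriangular : {N : ℕ} → Mat N → Set ℓ
  IsLowerUnitriangular {N} L =
    (∀ (i j : Fin N) → toℕ i <ℕ toℕ j → L i j ≈ 0#) × (∀ (i : Fin N) → L i i ≈ 1#)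

  IsUpperUnitriangular : {N : ℕ} → Mat N → Set ℓ
  IsUpperUnitriangular {N} U =
    (∀ (i j : Fin N) → toℕ j <ℕ toℕ i → U i j ≈ 0#) × (∀ (i : Fin N) → U i i ≈ 1#)

  IsDiagonal : {N : ℕ} → Mat N → Set ℓ
  IsDiagonal {N} D = ∀ (i j : Fin N) → ¬ (i ≡ j) → D i j ≈ 0#

  IsGaussDecomposition : {N : ℕ} → Mat N → Mat N → Mat N → Mat N → Set ℓ
  IsGaussDecomposition {N} X Xm X0 Xp =
    IsLowerUnitriangular Xm × IsDiagonal X0 × IsUpperUnitriangular Xp
      × (∀ (i j : Fin N) → X i j ≈ ((Xm ⊗ X0) ⊗ Xp) i j)

  -- entry (i , j) (0-based) of an N×N matrix; 0 outside the range (never used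
  -- under the hypotheses of the statement)
  entry : {N : ℕ} → Mat N → ℕ → ℕ → Carrier
  entry {N} A i j with i <? N | j <? N
  ... | yes i<N | yes j<N = A (fromℕ< i<N) (fromℕ< j<N)
  ... | _       | _       = 0#

  -- S^{(r)}_λ(X₊): minor of X₊ with rows {1..r} and columns
  -- J = {λ_{r+1-a} + a : 1 ≤ a ≤ r} (1-based), listed increasingly.
  -- With 0-based a' = a-1 the column is λ_{r-a'} + a' (0-based).
  S : {N : ℕ} → (r : ℕ) → Partition → Mat N → Carrier
  S r lam Xp = det r (λ a b → entry Xp (toℕ a) (lam (r ∸ toℕ b) +ℕ toℕ b))

-- For upper unitriangular U, the minor S^(r)_[m|q](U) uses columns 0, …, r − m − 1 of U and then
-- columns r − m + q, …, r − 1 + q.  Its leading (r − m)×(r − m) block is a diagonal block of U,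
-- unitriangular with zeros below it, so the minor equals the consecutive minor of U with rows
-- r − m, …, r − 1 and columns r − m + q, …, r − 1 + q.  The six minors of the identity thereby
-- become the interior and the four corner minors of a single (p+1)×(p+1) consecutive block of U,
-- and the identity is the Desnanot–Jacobi identity for that block.  Desnanot–Jacobi in turn is an
-- instance of a Plücker-type relation between the maximal minors of an (m+2)×(m+1) matrix, whose
-- proof is a sum of expansions by alien cofactors.
module Submission where

open import Defs
open import Level using (Level)
open import Data.Nat using (ℕ; _∸_; _≤_) renaming (_+_ to _+ℕ_)
open import Algebra.Bundles using (CommutativeRing)
open import Data.Nat using (zero; suc; _<_; _<?_; _≤ᵇ_; s≤s; z≤n)
open import Data.Nat.Properties as ℕ
  using ( ≤⇒≤ᵇ; ≤ᵇ⇒≤; <⇒≱; <⇒≤; m<n+m; m<n⇒0<n∸m; +-∸-comm; [m+n]∸[m+o]≡n∸o; m∸n≤m; +-suc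
        ; m≤m+n; ≤-trans; m≤n⇒∃[o]m+o≡n)
open import Data.Fin using (Fin; zero; suc; toℕ; inject₁; fromℕ; fromℕ<; punchIn)
open import Data.Fin.Properties
  using (punchInᵢ≢i; suc-injective; toℕ-inject₁; fromℕ≢inject₁; toℕ-fromℕ<; fromℕ<-cong; toℕ<n)
open import Data.Vec.Functional using (Vector; _∷_; updateAt)
open import Data.Vec.Functional.Properties using (updateAt-updates; updateAt-minimal)
open import Data.Bool using (true; false)
open import Data.Product using (_,_; proj₁; proj₂)
open import Data.Unit using (tt)
open import Data.Empty using (⊥-elim)
open import Function using (_∘_)
open import Relation.Nullary using (yes; no)
open import Relation.Binary.PropositionalEquality as ≡ using (_≡_; _≢_)

swapAdjacent : ∀ {n} → Fin n → Fin (suc n) → Fin (suc n)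
swapAdjacent zero    zero          = suc zero
swapAdjacent zero    (suc zero)    = zero
swapAdjacent zero    (suc (suc b)) = suc (suc b)
swapAdjacent (suc c) zero          = zero
swapAdjacent (suc c) (suc b)       = suc (swapAdjacent c b)

swapAdjacent-inject₁ : ∀ {n} (c : Fin n) → swapAdjacent c (inject₁ c) ≡ suc c
swapAdjacent-inject₁ zero    = ≡.refl
swapAdjacent-inject₁ (suc c) = ≡.cong suc (swapAdjacent-inject₁ c)

swapAdjacent-suc : ∀ {n} (c : Fin n) → swapAdjacent c (suc c) ≡ inject₁ c
swapAdjacent-suc zero    = ≡.refl
swapAdjacent-suc (suc c) = ≡.cong suc (swapAdjacent-suc c)

swapAdjacent-punchIn-inject₁ : ∀ {n} (c b : Fin n) →
  swapAdjacent c (punchIn (inject₁ c) b) ≡ punchIn (suc c) b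
swapAdjacent-punchIn-inject₁ zero    zero    = ≡.refl
swapAdjacent-punchIn-inject₁ zero    (suc b) = ≡.refl
swapAdjacent-punchIn-inject₁ (suc c) zero    = ≡.refl
swapAdjacent-punchIn-inject₁ (suc c) (suc b) = ≡.cong suc (swapAdjacent-punchIn-inject₁ c b)

swapAdjacent-punchIn-suc : ∀ {n} (c b : Fin n) →
  swapAdjacent c (punchIn (suc c) b) ≡ punchIn (inject₁ c) b
swapAdjacent-punchIn-suc zero    zero    = ≡.refl
swapAdjacent-punchIn-suc zero    (suc b) = ≡.refl
swapAdjacent-punchIn-suc (suc c) zero    = ≡.refl
swapAdjacent-punchIn-suc (suc c) (suc b) = ≡.cong suc (swapAdjacent-punchIn-suc c b)

-- How a position j sits relative to the swapped pair {inject₁ c, suc c}: if it is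
-- neither, deleting j turns the swap into an adjacent swap of one size smaller.
data AdjacentView {m : ℕ} (j : Fin (suc (suc m))) (c : Fin (suc m)) : Set where
  left  : j ≡ inject₁ c → AdjacentView j c
  right : j ≡ suc c → AdjacentView j c
  apart : (c′ : Fin m) →
          punchIn j (inject₁ c′) ≡ inject₁ c → punchIn j (suc c′) ≡ suc c →
          (∀ b → swapAdjacent c (punchIn j b) ≡ punchIn j (swapAdjacent c′ b)) →
          swapAdjacent c j ≡ j → AdjacentView j c

adjacentView : ∀ {m} (j : Fin (suc (suc m))) (c : Fin (suc m)) → AdjacentView j c
adjacentView zero                zero    = left ≡.refl
adjacentView zero                (suc c) = apart c ≡.refl ≡.refl (λ _ → ≡.refl) ≡.refl
adjacentView (suc zero)          zero    = right ≡.refl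
adjacentView {suc m} (suc (suc j)) zero  = apart zero ≡.refl ≡.refl commute ≡.refl
  where
  commute : ∀ b → swapAdjacent zero (punchIn (suc (suc j)) b) ≡
                  punchIn (suc (suc j)) (swapAdjacent zero b)
  commute zero          = ≡.refl
  commute (suc zero)    = ≡.refl
  commute (suc (suc b)) = ≡.refl
adjacentView {suc m} (suc j) (suc c) with adjacentView j c
... | left  e = left  (≡.cong suc e)
... | right e = right (≡.cong suc e)
... | apart c′ e₁ e₂ e₃ e₄ = apart (suc c′) (≡.cong suc e₁) (≡.cong suc e₂) commute (≡.cong suc e₄)
  where
  commute : ∀ b → swapAdjacent (suc c) (punchIn (suc j) b) ≡
                  punchIn (suc j) (swapAdjacent (suc c′) b)
  commute zero    = ≡.refl
  commute (suc b) = ≡.cong suc (e₃ b)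

moveToFront : ∀ {n} → Fin (suc n) → Fin (suc n) → Fin (suc n)
moveToFront j = j ∷ punchIn j

moveToFront-zero : ∀ {n} (b : Fin (suc n)) → moveToFront zero b ≡ b
moveToFront-zero zero    = ≡.refl
moveToFront-zero (suc b) = ≡.refl

moveToFront-suc : ∀ {n} (j : Fin n) (b : Fin (suc n)) →
  moveToFront (suc j) b ≡ swapAdjacent j (moveToFront (inject₁ j) b)
moveToFront-suc j zero    = ≡.sym (swapAdjacent-inject₁ j)
moveToFront-suc j (suc b) = ≡.sym (swapAdjacent-punchIn-inject₁ j b)

punchIn-fromℕ : ∀ {n} (a : Fin n) → punchIn (fromℕ n) a ≡ inject₁ a
punchIn-fromℕ zero    = ≡.refl
punchIn-fromℕ (suc a) = ≡.cong suc (punchIn-fromℕ a)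

module Determinant {ℓ₁ ℓ₂ : Level} (R : CommutativeRing ℓ₁ ℓ₂) where

  open CommutativeRing R hiding (zero)
  open import Algebra.Properties.Ring ring using (-‿distribˡ-*; -‿distribʳ-*; -‿involutive; -1*x≈-x)
  open import Algebra.Properties.AbelianGroup +-abelianGroup using (inverseˡ-unique; ⁻¹-∙-comm)
  open import Algebra.Properties.CommutativeSemigroup +-commutativeSemigroup
    using () renaming (x∙yz≈y∙xz to x+yz≈y+xz)
  open import Algebra.Properties.Semiring.Sum semiring
    using (sum; sum-cong-≋; sum-replicate-zero; sum-remove; ∑-comm; *-distribˡ-sum)
  open import Algebra.Solver.CommutativeMonoid *-commutativeMonoid using (solve; _⊕_; _⊜_)
  open import Relation.Binary.Reasoning.Setoid setoid

  sumF≡sum : ∀ n (f : Vector Carrier n) → sumF R n f ≡ sum f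
  sumF≡sum zero    f = ≡.refl
  sumF≡sum (suc n) f = ≡.cong (f zero +_) (sumF≡sum n (λ j → f (suc j)))

  sum-zero : ∀ {n} {f : Vector Carrier n} → (∀ i → f i ≈ 0#) → sum f ≈ 0#
  sum-zero {n} f≈0 = trans (sum-cong-≋ f≈0) (sum-replicate-zero n)

  sum-single : ∀ {n} (i : Fin n) (f : Vector Carrier n) →
    (∀ j → j ≢ i → f j ≈ 0#) → sum f ≈ f i
  sum-single {suc n} i f others = begin
    sum f                             ≈⟨ sum-remove {i = i} f ⟩
    f i + sum (λ j → f (punchIn i j)) ≈⟨ +-congˡ (sum-zero (λ j → others _ (punchInᵢ≢i i j))) ⟩
    f i + 0#                          ≈⟨ +-identityʳ _ ⟩
    f i                               ∎

  sum-neg : ∀ {n} (f : Vector Carrier n) → sum (λ i → - f i) ≈ - sum f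
  sum-neg f = begin
    sum (λ i → - f i)      ≈⟨ sum-cong-≋ (λ i → sym (-1*x≈-x (f i))) ⟩
    sum (λ i → - 1# * f i) ≈⟨ *-distribˡ-sum (- 1#) f ⟨
    - 1# * sum f           ≈⟨ -1*x≈-x (sum f) ⟩
    - sum f                ∎

  sum-swapAdjacent : ∀ {n} (c : Fin n) (f : Vector Carrier (suc n)) →
    sum (λ j → f (swapAdjacent c j)) ≈ sum f
  sum-swapAdjacent zero    f = x+yz≈y+xz (f (suc zero)) (f zero) _
  sum-swapAdjacent (suc c) f = +-congˡ (sum-swapAdjacent c (λ j → f (suc j)))

  sum-cancelAdjacent : ∀ {n} (c : Fin n) (f : Vector Carrier (suc n)) →
    f (inject₁ c) + f (suc c) ≈ 0# → (∀ j → j ≢ inject₁ c → j ≢ suc c → f j ≈ 0#) →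
    sum f ≈ 0#
  sum-cancelAdjacent zero f pair others = begin
    f zero + (f (suc zero) + sum (λ j → f (suc (suc j))))
      ≈⟨ +-assoc _ _ _ ⟨
    (f zero + f (suc zero)) + sum (λ j → f (suc (suc j)))
      ≈⟨ +-cong pair (sum-zero (λ j → others (suc (suc j)) (λ ()) (λ ()))) ⟩
    0# + 0#
      ≈⟨ +-identityˡ 0# ⟩
    0# ∎
  sum-cancelAdjacent (suc c) f pair others = begin
    f zero + sum (λ j → f (suc j)) ≈⟨ +-cong (others zero (λ ()) (λ ())) (sum-cancelAdjacent c _ pair others′) ⟩
    0# + 0#                        ≈⟨ +-identityˡ 0# ⟩
    0#                             ∎
    where
    others′ : ∀ j → j ≢ inject₁ c → j ≢ suc c → f (suc j) ≈ 0#
    others′ j j≢c j≢c+1 = others (suc j) (j≢c ∘ suc-injective) (j≢c+1 ∘ suc-injective)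

  sgn*sgn≈1 : ∀ k → sgn R k * sgn R k ≈ 1#
  sgn*sgn≈1 zero    = *-identityˡ 1#
  sgn*sgn≈1 (suc k) = begin
    - sgn R k * - sgn R k     ≈⟨ -‿distribˡ-* _ _ ⟨
    - (sgn R k * - sgn R k)   ≈⟨ -‿cong (-‿distribʳ-* _ _) ⟨
    - - (sgn R k * sgn R k)   ≈⟨ -‿involutive _ ⟩
    sgn R k * sgn R k         ≈⟨ sgn*sgn≈1 k ⟩
    1#                        ∎

  sgn-cancelˡ : ∀ k {x y} → sgn R k * x ≈ sgn R k * y → x ≈ y
  sgn-cancelˡ k {x} {y} eq = begin
    x                       ≈⟨ *-identityˡ x ⟨
    1# * x                  ≈⟨ *-congʳ (sgn*sgn≈1 k) ⟨
    sgn R k * sgn R k * x   ≈⟨ *-assoc _ _ _ ⟩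
    sgn R k * (sgn R k * x) ≈⟨ *-congˡ eq ⟩
    sgn R k * (sgn R k * y) ≈⟨ *-assoc _ _ _ ⟨
    sgn R k * sgn R k * y   ≈⟨ *-congʳ (sgn*sgn≈1 k) ⟩
    1# * y                  ≈⟨ *-identityˡ y ⟩
    y                       ∎

  -x*y*z≈-[x*y*z] : ∀ s x d → - s * x * d ≈ - (s * x * d)
  -x*y*z≈-[x*y*z] s x d = begin
    - s * x * d     ≈⟨ *-congʳ (-‿distribˡ-* s x) ⟨
    - (s * x) * d   ≈⟨ -‿distribˡ-* _ d ⟨
    - (s * x * d)   ∎

  -a*b*[c*d*e]≈-c*d*[a*b*e] : ∀ s t x y d → - s * x * (t * y * d) ≈ - t * y * (s * x * d)
  -a*b*[c*d*e]≈-c*d*[a*b*e] s t x y d = begin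
    - s * x * (t * y * d)    ≈⟨ *-congʳ (-‿distribˡ-* s x) ⟨
    - (s * x) * (t * y * d)  ≈⟨ -‿distribˡ-* _ _ ⟨
    - (s * x * (t * y * d))  ≈⟨ -‿cong (solve 5 (λ s t x y d → (s ⊕ x) ⊕ ((t ⊕ y) ⊕ d) ⊜ (t ⊕ y) ⊕ ((s ⊕ x) ⊕ d))
                                                refl s t x y d) ⟩
    - (t * y * (s * x * d))  ≈⟨ -‿distribˡ-* _ _ ⟩
    - (t * y) * (s * x * d)  ≈⟨ *-congʳ (-‿distribˡ-* t y) ⟩
    - t * y * (s * x * d)    ∎

  rowExpansionTerm : ∀ {n} → Mat R (suc n) → Fin (suc n) → Carrier
  rowExpansionTerm {n} M j = sgn R (toℕ j) * M zero j * det R n (λ a b → M (suc a) (punchIn j b))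

  columnExpansionTerm : ∀ {n} → Mat R (suc n) → Fin (suc n) → Carrier
  columnExpansionTerm {n} M i = sgn R (toℕ i) * M i zero * det R n (λ a b → M (punchIn i a) (suc b))

  det-expandFirstRow : ∀ {n} (M : Mat R (suc n)) → det R (suc n) M ≈ sum (rowExpansionTerm M)
  det-expandFirstRow {n} M = reflexive (sumF≡sum (suc n) (rowExpansionTerm M))

  det-cong : ∀ n {M M′ : Mat R n} → (∀ a b → M a b ≈ M′ a b) → det R n M ≈ det R n M′
  det-cong zero    M≈M′ = refl
  det-cong (suc n) {M} {M′} M≈M′ = begin
    det R (suc n) M          ≈⟨ det-expandFirstRow M ⟩
    sum (rowExpansionTerm M)  ≈⟨ sum-cong-≋ termwise ⟩
    sum (rowExpansionTerm M′) ≈⟨ det-expandFirstRow M′ ⟨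
    det R (suc n) M′         ∎
    where
    termwise : ∀ j → rowExpansionTerm M j ≈ rowExpansionTerm M′ j
    termwise j = *-cong (*-congˡ (M≈M′ zero j)) (det-cong n (λ a b → M≈M′ (suc a) (punchIn j b)))

  det-expandFirstColumn : ∀ n (M : Mat R (suc n)) → det R (suc n) M ≈ sum (columnExpansionTerm M)
  det-expandFirstColumn zero    M = refl
  det-expandFirstColumn (suc n) M = begin
    det R (suc (suc n)) M                                    ≈⟨ det-expandFirstRow M ⟩
    t₀ + sum (λ j → rowExpansionTerm M (suc j))              ≈⟨ +-congˡ (sum-cong-≋ rowTerm≈) ⟩
    t₀ + sum (λ j → sum (λ i → e i j))                       ≈⟨ +-congˡ (∑-comm (λ j i → e i j)) ⟩
    t₀ + sum (λ i → sum (λ j → e i j))                       ≈⟨ +-congˡ (sum-cong-≋ columnTerm≈) ⟨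
    t₀ + sum (λ i → columnExpansionTerm M (suc i))           ∎
    where
    s : ∀ {m} → Fin m → Carrier
    s i = sgn R (toℕ i)
    t₀ : Carrier
    t₀ = rowExpansionTerm M zero
    d : Fin (suc n) → Fin (suc n) → Carrier
    d i j = det R n (λ a b → M (suc (punchIn i a)) (suc (punchIn j b)))
    e : Fin (suc n) → Fin (suc n) → Carrier
    e i j = - s i * M (suc i) zero * (s j * M zero (suc j) * d i j)
    rowTerm≈ : ∀ j → rowExpansionTerm M (suc j) ≈ sum (λ i → e i j)
    rowTerm≈ j = begin
      - s j * M zero (suc j) * det R (suc n) (λ a b → M (suc a) (punchIn (suc j) b))
        ≈⟨ *-congˡ (det-expandFirstColumn n (λ a b → M (suc a) (punchIn (suc j) b))) ⟩
      - s j * M zero (suc j) * sum (λ i → s i * M (suc i) zero * d i j)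
        ≈⟨ *-distribˡ-sum (- s j * M zero (suc j)) (λ i → s i * M (suc i) zero * d i j) ⟩
      sum (λ i → - s j * M zero (suc j) * (s i * M (suc i) zero * d i j))
        ≈⟨ sum-cong-≋ (λ i → -a*b*[c*d*e]≈-c*d*[a*b*e] (s j) (s i) (M zero (suc j)) (M (suc i) zero) (d i j)) ⟩
      sum (λ i → e i j) ∎
    columnTerm≈ : ∀ i → columnExpansionTerm M (suc i) ≈ sum (λ j → e i j)
    columnTerm≈ i = trans (*-congˡ (det-expandFirstRow (λ a b → M (punchIn (suc i) a) (suc b))))
                          (*-distribˡ-sum (- s i * M (suc i) zero) (rowExpansionTerm (λ a b → M (punchIn (suc i) a) (suc b))))

  det-transpose : ∀ n (M : Mat R n) → det R n (λ a b → M b a) ≈ det R n M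
  det-transpose zero    M = refl
  det-transpose (suc n) M = begin
    det R (suc n) (λ a b → M b a)  ≈⟨ det-expandFirstRow (λ a b → M b a) ⟩
    sum (rowExpansionTerm (λ a b → M b a)) ≈⟨ sum-cong-≋ termwise ⟩
    sum (columnExpansionTerm M)            ≈⟨ det-expandFirstColumn n M ⟨
    det R (suc n) M                        ∎
    where
    termwise : ∀ i → rowExpansionTerm (λ a b → M b a) i ≈ columnExpansionTerm M i
    termwise i = *-congˡ (det-transpose n (λ a b → M (punchIn i a) (suc b)))

  det-swapAdjacentColumns : ∀ n (c : Fin n) (M : Mat R (suc n)) →
    det R (suc n) (λ a b → M a (swapAdjacent c b)) ≈ - det R (suc n) M
  det-swapAdjacentColumns (suc m) c M = begin
    det R (suc (suc m)) M′                             ≈⟨ det-expandFirstRow M′ ⟩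
    sum (rowExpansionTerm M′)                          ≈⟨ sum-cong-≋ termwise ⟩
    sum (λ j → - rowExpansionTerm M (swapAdjacent c j)) ≈⟨ sum-neg (λ j → rowExpansionTerm M (swapAdjacent c j)) ⟩
    - sum (λ j → rowExpansionTerm M (swapAdjacent c j)) ≈⟨ -‿cong (sum-swapAdjacent c (rowExpansionTerm M)) ⟩
    - sum (rowExpansionTerm M)                         ≈⟨ -‿cong (det-expandFirstRow M) ⟨
    - det R (suc (suc m)) M                            ∎
    where
    M′ : Mat R (suc (suc m))
    M′ a b = M a (swapAdjacent c b)
    termwise : ∀ j → rowExpansionTerm M′ j ≈ - rowExpansionTerm M (swapAdjacent c j)
    termwise j with adjacentView j c
    ... | left ≡.refl rewrite swapAdjacent-inject₁ c | toℕ-inject₁ c = begin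
      sgn R (toℕ c) * M zero (suc c) * det R (suc m) (λ a b → M (suc a) (swapAdjacent c (punchIn (inject₁ c) b)))
        ≈⟨ *-congˡ (det-cong (suc m) (λ a b → reflexive (≡.cong (M (suc a)) (swapAdjacent-punchIn-inject₁ c b)))) ⟩
      sgn R (toℕ c) * M zero (suc c) * det R (suc m) (λ a b → M (suc a) (punchIn (suc c) b))
        ≈⟨ -‿involutive _ ⟨
      - - (sgn R (toℕ c) * M zero (suc c) * det R (suc m) (λ a b → M (suc a) (punchIn (suc c) b)))
        ≈⟨ -‿cong (-x*y*z≈-[x*y*z] _ _ _) ⟨
      - rowExpansionTerm M (suc c) ∎
    ... | right ≡.refl rewrite swapAdjacent-suc c = begin
      - sgn R (toℕ c) * M zero (inject₁ c) * det R (suc m) (λ a b → M (suc a) (swapAdjacent c (punchIn (suc c) b)))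
        ≈⟨ *-congˡ (det-cong (suc m) (λ a b → reflexive (≡.cong (M (suc a)) (swapAdjacent-punchIn-suc c b)))) ⟩
      - sgn R (toℕ c) * M zero (inject₁ c) * det R (suc m) (λ a b → M (suc a) (punchIn (inject₁ c) b))
        ≈⟨ -x*y*z≈-[x*y*z] _ _ _ ⟩
      - (sgn R (toℕ c) * M zero (inject₁ c) * det R (suc m) (λ a b → M (suc a) (punchIn (inject₁ c) b)))
        ≈⟨ -‿cong (*-congʳ (*-congʳ (reflexive (≡.cong (sgn R) (toℕ-inject₁ c))))) ⟨
      - rowExpansionTerm M (inject₁ c) ∎
    ... | apart c′ _ _ commute fixed rewrite fixed = begin
      sgn R (toℕ j) * M zero j * det R (suc m) (λ a b → M (suc a) (swapAdjacent c (punchIn j b)))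
        ≈⟨ *-congˡ (det-cong (suc m) (λ a b → reflexive (≡.cong (M (suc a)) (commute b)))) ⟩
      sgn R (toℕ j) * M zero j * det R (suc m) (λ a b → M (suc a) (punchIn j (swapAdjacent c′ b)))
        ≈⟨ *-congˡ (det-swapAdjacentColumns m c′ (λ a b → M (suc a) (punchIn j b))) ⟩
      sgn R (toℕ j) * M zero j * - det R (suc m) (λ a b → M (suc a) (punchIn j b))
        ≈⟨ -‿distribʳ-* _ _ ⟨
      - rowExpansionTerm M j ∎

  swapAdjacent-invariant : ∀ {n} (c : Fin n) (v : Vector Carrier (suc n)) →
    v (inject₁ c) ≈ v (suc c) → ∀ b → v (swapAdjacent c b) ≈ v b
  swapAdjacent-invariant zero    v v≈ zero          = sym v≈
  swapAdjacent-invariant zero    v v≈ (suc zero)    = v≈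
  swapAdjacent-invariant zero    v v≈ (suc (suc b)) = refl
  swapAdjacent-invariant (suc c) v v≈ zero          = refl
  swapAdjacent-invariant (suc c) v v≈ (suc b)       = swapAdjacent-invariant c (λ b → v (suc b)) v≈ b

  det-equalAdjacentColumns : ∀ n (c : Fin n) (M : Mat R (suc n)) →
    (∀ a → M a (inject₁ c) ≈ M a (suc c)) → det R (suc n) M ≈ 0#
  det-equalAdjacentColumns (suc m) c M cols≈ =
    trans (det-expandFirstRow M) (sum-cancelAdjacent c (rowExpansionTerm M) pair others)
    where
    D : Carrier
    D = det R (suc m) (λ a b → M (suc a) (punchIn (inject₁ c) b))
    pair : rowExpansionTerm M (inject₁ c) + rowExpansionTerm M (suc c) ≈ 0#
    pair = begin
      rowExpansionTerm M (inject₁ c) + rowExpansionTerm M (suc c)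
        ≈⟨ +-cong (*-congʳ (*-congʳ (reflexive (≡.cong (sgn R) (toℕ-inject₁ c)))))
                  (*-cong (*-congˡ (sym (cols≈ zero))) (det-cong (suc m) λ a b → begin
                    M (suc a) (punchIn (suc c) b)
                      ≡⟨ ≡.cong (M (suc a)) (swapAdjacent-punchIn-inject₁ c b) ⟨
                    M (suc a) (swapAdjacent c (punchIn (inject₁ c) b))
                      ≈⟨ swapAdjacent-invariant c (M (suc a)) (cols≈ (suc a)) _ ⟩
                    M (suc a) (punchIn (inject₁ c) b) ∎)) ⟩
      sgn R (toℕ c) * M zero (inject₁ c) * D + - sgn R (toℕ c) * M zero (inject₁ c) * D
        ≈⟨ +-congˡ (-x*y*z≈-[x*y*z] _ _ _) ⟩
      sgn R (toℕ c) * M zero (inject₁ c) * D + - (sgn R (toℕ c) * M zero (inject₁ c) * D)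
        ≈⟨ -‿inverseʳ _ ⟩
      0# ∎
    others : ∀ j → j ≢ inject₁ c → j ≢ suc c → rowExpansionTerm M j ≈ 0#
    others j j≢c j≢c+1 with adjacentView j c
    ... | left  j≡c   = ⊥-elim (j≢c j≡c)
    ... | right j≡c+1 = ⊥-elim (j≢c+1 j≡c+1)
    ... | apart c′ e₁ e₂ _ _ = trans (*-congˡ minor≈0) (zeroʳ _)
      where
      minor≈0 : det R (suc m) (λ a b → M (suc a) (punchIn j b)) ≈ 0#
      minor≈0 = det-equalAdjacentColumns m c′ (λ a b → M (suc a) (punchIn j b))
        (λ a → ≡.subst₂ (λ u v → M (suc a) u ≈ M (suc a) v) (≡.sym e₁) (≡.sym e₂) (cols≈ (suc a)))

  det-moveToFrontColumns : ∀ n (j : Fin (suc n)) (M : Mat R (suc n)) →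
    det R (suc n) (λ a b → M a (moveToFront j b)) ≈ sgn R (toℕ j) * det R (suc n) M
  det-moveToFrontColumns n j = go (toℕ j) j ≡.refl
    where
    -- recursing on j itself would go through inject₁ j, which is not structurally smaller
    go : ∀ k (j : Fin (suc n)) → toℕ j ≡ k → ∀ M →
      det R (suc n) (λ a b → M a (moveToFront j b)) ≈ sgn R (toℕ j) * det R (suc n) M
    go zero    zero    _    M = begin
      det R (suc n) (λ a b → M a (moveToFront zero b))
        ≈⟨ det-cong (suc n) (λ a b → reflexive (≡.cong (M a) (moveToFront-zero b))) ⟩
      det R (suc n) M
        ≈⟨ *-identityˡ _ ⟨
      1# * det R (suc n) M ∎
    go (suc k) (suc j) j≡k M = begin
      det R (suc n) (λ a b → M a (moveToFront (suc j) b))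
        ≈⟨ det-cong (suc n) (λ a b → reflexive (≡.cong (M a) (moveToFront-suc j b))) ⟩
      det R (suc n) (λ a b → M a (swapAdjacent j (moveToFront (inject₁ j) b)))
        ≈⟨ go k (inject₁ j) (≡.trans (toℕ-inject₁ j) (ℕ.suc-injective j≡k)) (λ a b → M a (swapAdjacent j b)) ⟩
      sgn R (toℕ (inject₁ j)) * det R (suc n) (λ a b → M a (swapAdjacent j b))
        ≈⟨ *-cong (reflexive (≡.cong (sgn R) (toℕ-inject₁ j))) (det-swapAdjacentColumns n j M) ⟩
      sgn R (toℕ j) * - det R (suc n) M
        ≈⟨ -‿distribʳ-* _ _ ⟨
      - (sgn R (toℕ j) * det R (suc n) M)
        ≈⟨ -‿distribˡ-* _ _ ⟩
      - sgn R (toℕ j) * det R (suc n) M ∎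

  det-moveToFrontRows : ∀ n (i : Fin (suc n)) (M : Mat R (suc n)) →
    det R (suc n) (λ a b → M (moveToFront i a) b) ≈ sgn R (toℕ i) * det R (suc n) M
  det-moveToFrontRows n i M = begin
    det R (suc n) (λ a b → M (moveToFront i a) b)  ≈⟨ det-transpose (suc n) (λ a b → M (moveToFront i a) b) ⟨
    det R (suc n) (λ a b → M (moveToFront i b) a)  ≈⟨ det-moveToFrontColumns n i (λ a b → M b a) ⟩
    sgn R (toℕ i) * det R (suc n) (λ a b → M b a)  ≈⟨ *-congˡ (det-transpose (suc n) M) ⟩
    sgn R (toℕ i) * det R (suc n) M                ∎

  det-equalAdjacentRows : ∀ n (c : Fin n) (M : Mat R (suc n)) →
    (∀ b → M (inject₁ c) b ≈ M (suc c) b) → det R (suc n) M ≈ 0#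
  det-equalAdjacentRows n c M rows≈ =
    trans (sym (det-transpose (suc n) M)) (det-equalAdjacentColumns n c (λ a b → M b a) rows≈)

  det-equalFirstRow : ∀ n (i : Fin n) (M : Mat R (suc n)) →
    (∀ b → M zero b ≈ M (suc i) b) → det R (suc n) M ≈ 0#
  det-equalFirstRow (suc n) i M rows≈ = sgn-cancelˡ (toℕ (suc i)) (begin
    sgn R (toℕ (suc i)) * det R (suc (suc n)) M   ≈⟨ det-moveToFrontRows (suc n) (suc i) M ⟨
    det R (suc (suc n)) (λ a b → M (moveToFront (suc i) a) b)
      ≈⟨ det-equalAdjacentRows (suc n) zero (λ a b → M (moveToFront (suc i) a) b) (λ b → sym (rows≈ b)) ⟩
    0#                                            ≈⟨ zeroʳ _ ⟨
    sgn R (toℕ (suc i)) * 0#                      ∎)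

  det-equalFirstColumn : ∀ n (i : Fin n) (M : Mat R (suc n)) →
    (∀ a → M a zero ≈ M a (suc i)) → det R (suc n) M ≈ 0#
  det-equalFirstColumn n i M cols≈ =
    trans (sym (det-transpose (suc n) M)) (det-equalFirstRow n i (λ a b → M b a) cols≈)

  basis : ∀ {n} → Fin n → Vector Carrier n
  basis zero    zero    = 1#
  basis zero    (suc _) = 0#
  basis (suc _) zero    = 0#
  basis (suc i) (suc j) = basis i j

  basis-diagonal : ∀ {n} (i : Fin n) → basis i i ≈ 1#
  basis-diagonal zero    = refl
  basis-diagonal (suc i) = basis-diagonal i

  basis-offDiagonal : ∀ {n} (i j : Fin n) → j ≢ i → basis i j ≈ 0#
  basis-offDiagonal zero    zero    j≢i = ⊥-elim (j≢i ≡.refl)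
  basis-offDiagonal zero    (suc j) _   = refl
  basis-offDiagonal (suc i) zero    _   = refl
  basis-offDiagonal (suc i) (suc j) j≢i = basis-offDiagonal i j (j≢i ∘ ≡.cong suc)

  det-basisFirstRow : ∀ n (j : Fin (suc n)) (M : Mat R (suc n)) → (∀ b → M zero b ≈ basis j b) →
    det R (suc n) M ≈ sgn R (toℕ j) * det R n (λ a b → M (suc a) (punchIn j b))
  det-basisFirstRow n j M row≈ = begin
    det R (suc n) M                  ≈⟨ det-expandFirstRow M ⟩
    sum (rowExpansionTerm M)         ≈⟨ sum-single j (rowExpansionTerm M) others ⟩
    rowExpansionTerm M j             ≈⟨ *-congʳ (*-congˡ (trans (row≈ j) (basis-diagonal j))) ⟩
    sgn R (toℕ j) * 1# * D           ≈⟨ *-congʳ (*-identityʳ _) ⟩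
    sgn R (toℕ j) * D                ∎
    where
    D : Carrier
    D = det R n (λ a b → M (suc a) (punchIn j b))
    others : ∀ k → k ≢ j → rowExpansionTerm M k ≈ 0#
    others k k≢j = begin
      rowExpansionTerm M k ≈⟨ *-congʳ (*-congˡ (trans (row≈ k) (basis-offDiagonal j k k≢j))) ⟩
      sgn R (toℕ k) * 0# * det R n (λ a b → M (suc a) (punchIn k b)) ≈⟨ *-congʳ (zeroʳ _) ⟩
      0# * det R n (λ a b → M (suc a) (punchIn k b))                ≈⟨ zeroˡ _ ⟩
      0#                                                             ∎

  det-unitFirstRow : ∀ n (M : Mat R (suc n)) → (∀ b → M zero b ≈ basis zero b) →
    det R (suc n) M ≈ det R n (λ a b → M (suc a) (suc b))
  det-unitFirstRow n M row≈ = trans (det-basisFirstRow n zero M row≈) (*-identityˡ _)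

  det-unitFirstColumn : ∀ n (M : Mat R (suc n)) → (∀ a → M a zero ≈ basis zero a) →
    det R (suc n) M ≈ det R n (λ a b → M (suc a) (suc b))
  det-unitFirstColumn n M column≈ = begin
    det R (suc n) M                          ≈⟨ det-transpose (suc n) M ⟨
    det R (suc n) (λ a b → M b a)            ≈⟨ det-unitFirstRow n (λ a b → M b a) column≈ ⟩
    det R n (λ a b → M (suc b) (suc a))      ≈⟨ det-transpose n (λ a b → M (suc a) (suc b)) ⟩
    det R n (λ a b → M (suc a) (suc b))      ∎

  det-unitLastRow : ∀ n (M : Mat R (suc n)) → (∀ b → M (fromℕ n) b ≈ basis (fromℕ n) b) →
    det R (suc n) M ≈ det R n (λ a b → M (inject₁ a) (inject₁ b))
  det-unitLastRow n M row≈ = sgn-cancelˡ (toℕ (fromℕ n)) (begin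
    sgn R (toℕ (fromℕ n)) * det R (suc n) M
      ≈⟨ det-moveToFrontRows n (fromℕ n) M ⟨
    det R (suc n) (λ a b → M (moveToFront (fromℕ n) a) b)
      ≈⟨ det-basisFirstRow n (fromℕ n) (λ a b → M (moveToFront (fromℕ n) a) b) row≈ ⟩
    sgn R (toℕ (fromℕ n)) * det R n (λ a b → M (punchIn (fromℕ n) a) (punchIn (fromℕ n) b))
      ≈⟨ *-congˡ (det-cong n (λ a b → reflexive (≡.cong₂ M (punchIn-fromℕ a) (punchIn-fromℕ b)))) ⟩
    sgn R (toℕ (fromℕ n)) * det R n (λ a b → M (inject₁ a) (inject₁ b)) ∎)

  sum-alienCofactors : ∀ m (V : Fin (suc (suc m)) → Vector Carrier (suc m)) (i : Fin (suc m)) →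
    sum (λ k → sgn R (toℕ k) * V k i * det R (suc m) (λ a b → V (punchIn k a) b)) ≈ 0#
  sum-alienCofactors m V i = trans (sym (det-expandFirstColumn (suc m) V′)) (det-equalFirstColumn (suc m) i V′ (λ _ → refl))
    where
    V′ : Mat R (suc (suc m))
    V′ a = V a i ∷ V a

  plücker : ∀ m (V : Fin (suc (suc m)) → Vector Carrier (suc m)) (W : Fin m → Vector Carrier (suc m)) →
    sum (λ k → sgn R (toℕ k) * det R (suc m) (λ a b → V (punchIn k a) b) * det R (suc m) (V k ∷ W)) ≈ 0#
  plücker m V W = begin
    sum (λ k → s k * d k * det R (suc m) (V k ∷ W))           ≈⟨ sum-cong-≋ expand ⟩
    sum (λ k → sum (λ i → s k * d k * (s i * V k i * c i)))   ≈⟨ ∑-comm (λ k i → s k * d k * (s i * V k i * c i)) ⟩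
    sum (λ i → sum (λ k → s k * d k * (s i * V k i * c i)))   ≈⟨ sum-cong-≋ factor ⟩
    sum (λ i → s i * c i * sum (λ k → s k * V k i * d k))     ≈⟨ sum-zero vanish ⟩
    0#                                                        ∎
    where
    s : ∀ {n} → Fin n → Carrier
    s k = sgn R (toℕ k)
    d : Fin (suc (suc m)) → Carrier
    d k = det R (suc m) (λ a b → V (punchIn k a) b)
    c : Fin (suc m) → Carrier
    c i = det R m (λ a b → W a (punchIn i b))
    expand : ∀ k → s k * d k * det R (suc m) (V k ∷ W) ≈ sum (λ i → s k * d k * (s i * V k i * c i))
    expand k = trans (*-congˡ (det-expandFirstRow (V k ∷ W))) (*-distribˡ-sum (s k * d k) (rowExpansionTerm (V k ∷ W)))
    vanish : ∀ i → s i * c i * sum (λ k → s k * V k i * d k) ≈ 0#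
    vanish i = trans (*-congˡ (sum-alienCofactors m V i)) (zeroʳ _)
    factor : ∀ i → sum (λ k → s k * d k * (s i * V k i * c i)) ≈ s i * c i * sum (λ k → s k * V k i * d k)
    factor i = begin
      sum (λ k → s k * d k * (s i * V k i * c i))
        ≈⟨ sum-cong-≋ (λ k → solve 5 (λ a b x y z → (a ⊕ b) ⊕ ((x ⊕ y) ⊕ z) ⊜ (x ⊕ z) ⊕ ((a ⊕ y) ⊕ b))
                                     refl (s k) (d k) (s i) (V k i) (c i)) ⟩
      sum (λ k → s i * c i * (s k * V k i * d k))
        ≈⟨ *-distribˡ-sum (s i * c i) (λ k → s k * V k i * d k) ⟨
      s i * c i * sum (λ k → s k * V k i * d k) ∎

  x+[-y+z]≈0⇒x≈y-z : ∀ x y z → x + (- y + z) ≈ 0# → x ≈ y - z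
  x+[-y+z]≈0⇒x≈y-z x y z sum≈0 = begin
    x             ≈⟨ inverseˡ-unique x (- y + z) sum≈0 ⟩
    - (- y + z)   ≈⟨ ⁻¹-∙-comm (- y) z ⟨
    - - y + - z   ≈⟨ +-congʳ (-‿involutive y) ⟩
    y - z         ∎

  desnanot-jacobi : ∀ n (A : Mat R (suc (suc n))) →
    det R (suc (suc n)) A * det R n (λ a b → A (suc (inject₁ a)) (suc (inject₁ b)))
      ≈ det R (suc n) (λ a b → A (suc a) (suc b)) * det R (suc n) (λ a b → A (inject₁ a) (inject₁ b))
        - det R (suc n) (λ a b → A (suc a) (inject₁ b)) * det R (suc n) (λ a b → A (inject₁ a) (suc b))
  desnanot-jacobi n A = x+[-y+z]≈0⇒x≈y-z _ _ _ (begin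
    det R (suc (suc n)) A * interior + (- (lowerRight * upperLeft) + lowerLeft * upperRight)
      ≈⟨ +-cong first (+-cong second rest) ⟨
    t zero + (t (suc zero) + sum (λ k → t (suc (suc k))))
      ≈⟨ plücker (suc n) V W ⟩
    0# ∎)
    where
    interior lowerRight upperLeft lowerLeft upperRight : Carrier
    interior   = det R n (λ a b → A (suc (inject₁ a)) (suc (inject₁ b)))
    lowerRight = det R (suc n) (λ a b → A (suc a) (suc b))
    upperLeft  = det R (suc n) (λ a b → A (inject₁ a) (inject₁ b))
    lowerLeft  = det R (suc n) (λ a b → A (suc a) (inject₁ b))
    upperRight = det R (suc n) (λ a b → A (inject₁ a) (suc b))

    -- The Plücker relation for V = e₀ ∷ A and W = (rows 1, …, n of A) ∷ʳ e_last: the terms k = 0, 1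
    -- and n + 2 are the three products of the identity, and every other term has a repeated row.
    V : Fin (suc (suc (suc n))) → Vector Carrier (suc (suc n))
    V = basis zero ∷ A
    W : Fin (suc n) → Vector Carrier (suc (suc n))
    W = updateAt (λ k → A (suc k)) (fromℕ n) (λ _ → basis (fromℕ (suc n)))
    t : Fin (suc (suc (suc n))) → Carrier
    t k = sgn R (toℕ k) * det R (suc (suc n)) (λ a b → V (punchIn k a) b) * det R (suc (suc n)) (V k ∷ W)

    W-last : W (fromℕ n) ≡ basis (fromℕ (suc n))
    W-last = updateAt-updates (fromℕ n) (λ k → A (suc k))
    W-other : ∀ k → k ≢ fromℕ n → W k ≡ A (suc k)
    W-other k k≢n = updateAt-minimal k (fromℕ n) (λ k → A (suc k)) k≢n
    W-inject₁ : ∀ k → W (inject₁ k) ≡ A (suc (inject₁ k))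
    W-inject₁ k = W-other (inject₁ k) (fromℕ≢inject₁ ∘ ≡.sym)

    det-dropLastRow : ∀ v → det R (suc (suc n)) (v ∷ W) ≈ det R (suc n) (λ a b → (v ∷ W) (inject₁ a) (inject₁ b))
    det-dropLastRow v = det-unitLastRow (suc n) (v ∷ W) (λ b → reflexive (≡.cong (λ w → w b) W-last))

    first : t zero ≈ det R (suc (suc n)) A * interior
    first = begin
      1# * det R (suc (suc n)) A * det R (suc (suc n)) (basis zero ∷ W)
        ≈⟨ *-congʳ (*-identityˡ _) ⟩
      det R (suc (suc n)) A * det R (suc (suc n)) (basis zero ∷ W)
        ≈⟨ *-congˡ (det-unitFirstRow (suc n) (basis zero ∷ W) (λ _ → refl)) ⟩
      det R (suc (suc n)) A * det R (suc n) (λ a b → W a (suc b))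
        ≈⟨ *-congˡ (det-unitLastRow n (λ a b → W a (suc b)) (λ b → reflexive (≡.cong (λ w → w (suc b)) W-last))) ⟩
      det R (suc (suc n)) A * det R n (λ a b → W (inject₁ a) (suc (inject₁ b)))
        ≈⟨ *-congˡ (det-cong n (λ a b → reflexive (≡.cong (λ w → w (suc (inject₁ b))) (W-inject₁ a)))) ⟩
      det R (suc (suc n)) A * interior ∎

    second : t (suc zero) ≈ - (lowerRight * upperLeft)
    second = begin
      - 1# * det R (suc (suc n)) (λ a b → V (punchIn (suc zero) a) b) * det R (suc (suc n)) (A zero ∷ W)
        ≈⟨ *-cong (*-congˡ (det-unitFirstRow (suc n) (λ a b → V (punchIn (suc zero) a) b) (λ _ → refl)))
                  (trans (det-dropLastRow (A zero)) (det-cong (suc n) rows)) ⟩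
      - 1# * lowerRight * upperLeft       ≈⟨ -x*y*z≈-[x*y*z] 1# lowerRight upperLeft ⟩
      - (1# * lowerRight * upperLeft)     ≈⟨ -‿cong (*-congʳ (*-identityˡ lowerRight)) ⟩
      - (lowerRight * upperLeft)          ∎
      where
      rows : ∀ a b → (A zero ∷ W) (inject₁ a) (inject₁ b) ≈ A (inject₁ a) (inject₁ b)
      rows zero    b = refl
      rows (suc a) b = reflexive (≡.cong (λ w → w (inject₁ b)) (W-inject₁ a))

    last : t (suc (suc (fromℕ n))) ≈ lowerLeft * upperRight
    last = begin
      - - s * det R (suc (suc n)) (λ a b → V (punchIn lastRow a) b) * det R (suc (suc n)) (V lastRow ∷ W)
        ≈⟨ *-cong (*-cong (-‿involutive s) (trans (det-unitFirstRow (suc n) (λ a b → V (punchIn lastRow a) b) (λ _ → refl))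
                                                  (det-cong (suc n) columnsRight)))
                  (trans (det-dropLastRow (V lastRow)) (det-cong (suc n) rowsLeft)) ⟩
      s * upperRight * det R (suc n) (λ a b → A (suc (moveToFront (fromℕ n) a)) (inject₁ b))
        ≈⟨ *-congˡ (det-moveToFrontRows n (fromℕ n) (λ a b → A (suc a) (inject₁ b))) ⟩
      s * upperRight * (s * lowerLeft)
        ≈⟨ solve 3 (λ s x y → (s ⊕ x) ⊕ (s ⊕ y) ⊜ (s ⊕ s) ⊕ (y ⊕ x)) refl s upperRight lowerLeft ⟩
      s * s * (lowerLeft * upperRight)   ≈⟨ *-congʳ (sgn*sgn≈1 (toℕ (fromℕ n))) ⟩
      1# * (lowerLeft * upperRight)      ≈⟨ *-identityˡ _ ⟩
      lowerLeft * upperRight             ∎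
      where
      lastRow : Fin (suc (suc (suc n)))
      lastRow = suc (suc (fromℕ n))
      s : Carrier
      s = sgn R (toℕ (fromℕ n))
      columnsRight : ∀ a b → V (punchIn lastRow (suc a)) (suc b) ≈ A (inject₁ a) (suc b)
      columnsRight a b = reflexive (≡.cong (λ i → A i (suc b)) (punchIn-fromℕ a))
      rowsLeft : ∀ a b → (A (suc (fromℕ n)) ∷ W) (inject₁ a) (inject₁ b) ≈ A (suc (moveToFront (fromℕ n) a)) (inject₁ b)
      rowsLeft zero    b = refl
      rowsLeft (suc a) b = reflexive (≡.trans (≡.cong (λ w → w (inject₁ b)) (W-inject₁ a))
                                              (≡.cong (λ i → A (suc i) (inject₁ b)) (≡.sym (punchIn-fromℕ a))))

    rest : sum (λ k → t (suc (suc k))) ≈ lowerLeft * upperRight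
    rest = trans (sum-single (fromℕ n) (λ k → t (suc (suc k))) repeated) last
      where
      repeated : ∀ k → k ≢ fromℕ n → t (suc (suc k)) ≈ 0#
      repeated k k≢n = trans (*-congˡ (det-equalFirstRow (suc n) k (A (suc k) ∷ W)
                                         (λ b → reflexive (≡.cong (λ w → w b) (≡.sym (W-other k k≢n))))))
                             (zeroʳ _)

rect-inside : ∀ m q {i} → 1 ≤ i → i ≤ m → rect m q i ≡ q
rect-inside m q {suc i} _ i≤m with suc i ≤ᵇ m | ≤⇒≤ᵇ i≤m
... | true | _ = ≡.refl

rect-outside : ∀ m q {i} → m < i → rect m q i ≡ 0
rect-outside m q {suc i} m<i with suc i ≤ᵇ m | ≤ᵇ⇒≤ (suc i) m
... | false | _   = ≡.refl
... | true  | i≤m = ⊥-elim (<⇒≱ m<i (i≤m tt))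

rectColumn-prefix : ∀ t m q {b} → b < t → rect m q (t +ℕ m ∸ b) +ℕ b ≡ b
rectColumn-prefix t m q {b} b<t = ≡.cong (_+ℕ b) (rect-outside m q m<t+m-b)
  where
  m<t+m-b : m < t +ℕ m ∸ b
  m<t+m-b = ≡.subst (m <_) (≡.sym (+-∸-comm m (<⇒≤ b<t))) (m<n+m m (m<n⇒0<n∸m b<t))

rectColumn-suffix : ∀ t m q {b} → b < m → rect m q (t +ℕ m ∸ (t +ℕ b)) +ℕ (t +ℕ b) ≡ t +ℕ q +ℕ b
rectColumn-suffix t m q {b} b<m = begin
  rect m q (t +ℕ m ∸ (t +ℕ b)) +ℕ (t +ℕ b) ≡⟨ ≡.cong (λ i → rect m q i +ℕ (t +ℕ b)) ([m+n]∸[m+o]≡n∸o t m b) ⟩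
  rect m q (m ∸ b) +ℕ (t +ℕ b)
    ≡⟨ ≡.cong (_+ℕ (t +ℕ b)) (rect-inside m q (m<n⇒0<n∸m b<m) (m∸n≤m m b)) ⟩
  q +ℕ (t +ℕ b)                            ≡⟨ ℕ.+-assoc q t b ⟨
  q +ℕ t +ℕ b                              ≡⟨ ≡.cong (_+ℕ b) (ℕ.+-comm q t) ⟩
  t +ℕ q +ℕ b                              ∎
  where open ≡.≡-Reasoning

module UnitriangularMinors {ℓ₁ ℓ₂ : Level} (R : CommutativeRing ℓ₁ ℓ₂)
                           {N : ℕ} (U : Mat R N) (upper : IsUpperUnitriangular R U) where

  open CommutativeRing R hiding (zero)
  open Determinant R
  open import Relation.Binary.Reasoning.Setoid setoid

  entry-belowDiagonal : ∀ i j → j < i → entry R U i j ≈ 0#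
  entry-belowDiagonal i j j<i with i <? N | j <? N
  ... | yes i<N | yes j<N = proj₁ upper (fromℕ< i<N) (fromℕ< j<N)
                              (≡.subst₂ _<_ (≡.sym (toℕ-fromℕ< j<N)) (≡.sym (toℕ-fromℕ< i<N)) j<i)
  ... | yes _   | no _    = refl
  ... | no _    | _       = refl

  entry-diagonal : ∀ i → i < N → entry R U i i ≈ 1#
  entry-diagonal i i<N with i <? N | i <? N
  ... | yes p | yes q = trans (reflexive (≡.cong (U (fromℕ< p)) (fromℕ<-cong i i ≡.refl q p))) (proj₂ upper (fromℕ< p))
  ... | yes _ | no i≮N = ⊥-elim (i≮N i<N)
  ... | no i≮N | _    = ⊥-elim (i≮N i<N)

  window : ℕ → ℕ → (m : ℕ) → Mat R m
  window i j m a b = entry R U (i +ℕ toℕ a) (j +ℕ toℕ b)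

  det-dropLeadingDiagonalBlock : ∀ t s n (κ : ℕ → ℕ) → s +ℕ t ≤ N → (∀ b → b < t → κ b ≡ s +ℕ b) →
    det R (t +ℕ n) (λ a b → entry R U (s +ℕ toℕ a) (κ (toℕ b)))
      ≈ det R n (λ a b → entry R U (s +ℕ t +ℕ toℕ a) (κ (t +ℕ toℕ b)))
  det-dropLeadingDiagonalBlock zero    s n κ _ _ =
    det-cong n (λ a b → reflexive (≡.cong (λ i → entry R U (i +ℕ toℕ a) (κ (toℕ b))) (≡.sym (ℕ.+-identityʳ s))))
  det-dropLeadingDiagonalBlock (suc t) s n κ s+t≤N prefix = begin
    det R (suc t +ℕ n) (λ a b → entry R U (s +ℕ toℕ a) (κ (toℕ b)))
      ≈⟨ det-unitFirstColumn (t +ℕ n) (λ a b → entry R U (s +ℕ toℕ a) (κ (toℕ b))) firstColumn ⟩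
    det R (t +ℕ n) (λ a b → entry R U (s +ℕ suc (toℕ a)) (κ (suc (toℕ b))))
      ≈⟨ det-cong (t +ℕ n) (λ a b → reflexive (≡.cong (λ i → entry R U i (κ (suc (toℕ b)))) (+-suc s (toℕ a)))) ⟩
    det R (t +ℕ n) (λ a b → entry R U (suc s +ℕ toℕ a) (κ (suc (toℕ b))))
      ≈⟨ det-dropLeadingDiagonalBlock t (suc s) n (λ b → κ (suc b)) (≡.subst (_≤ N) (+-suc s t) s+t≤N)
           (λ b b<t → ≡.trans (prefix (suc b) (s≤s b<t)) (+-suc s b)) ⟩
    det R n (λ a b → entry R U (suc s +ℕ t +ℕ toℕ a) (κ (suc t +ℕ toℕ b)))
      ≈⟨ det-cong n (λ a b → reflexive (≡.cong (λ i → entry R U (i +ℕ toℕ a) (κ (suc t +ℕ toℕ b))) (≡.sym (+-suc s t)))) ⟩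
    det R n (λ a b → entry R U (s +ℕ suc t +ℕ toℕ a) (κ (suc t +ℕ toℕ b))) ∎
    where
    diagonal : κ 0 ≡ s
    diagonal = ≡.trans (prefix 0 (s≤s z≤n)) (ℕ.+-identityʳ s)
    firstColumn : ∀ a → entry R U (s +ℕ toℕ a) (κ 0) ≈ basis zero a
    firstColumn zero    = trans (reflexive (≡.cong₂ (entry R U) (ℕ.+-identityʳ s) diagonal))
                                (entry-diagonal s (≤-trans (m≤m+n (suc s) t) (≡.subst (_≤ N) (+-suc s t) s+t≤N)))
    firstColumn (suc a) = entry-belowDiagonal _ _ (≡.subst (_< s +ℕ suc (toℕ a)) (≡.sym diagonal) (ℕ.m<m+n s (s≤s z≤n)))

  S-rect≈det-window : ∀ {r h} t m q j → r ≡ t +ℕ m → h ≡ m → t +ℕ q ≡ j → r ≤ N →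
    S R r (rect h q) U ≈ det R m (window t j m)
  S-rect≈det-window t m q _ ≡.refl ≡.refl ≡.refl t+m≤N = begin
    S R (t +ℕ m) (rect m q) U
      ≈⟨ det-dropLeadingDiagonalBlock t 0 m column (≤-trans (m≤m+n t m) t+m≤N) (λ _ → rectColumn-prefix t m q) ⟩
    det R m (λ a b → entry R U (t +ℕ toℕ a) (column (t +ℕ toℕ b)))
      ≈⟨ det-cong m (λ a b → reflexive (≡.cong (entry R U (t +ℕ toℕ a)) (rectColumn-suffix t m q (toℕ<n b)))) ⟩
    det R m (window t (t +ℕ q) m) ∎
    where
    column : ℕ → ℕ
    column b = rect m q (t +ℕ m ∸ b) +ℕ b

  det-window-reindex : ∀ m {n} i j i′ j′ (ρ κ : Fin m → Fin n) →
    (∀ a → i +ℕ toℕ (ρ a) ≡ i′ +ℕ toℕ a) → (∀ b → j +ℕ toℕ (κ b) ≡ j′ +ℕ toℕ b) →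
    det R m (λ a b → window i j n (ρ a) (κ b)) ≈ det R m (window i′ j′ m)
  det-window-reindex m i j i′ j′ ρ κ rows columns =
    det-cong m (λ a b → reflexive (≡.cong₂ (entry R U) (rows a) (columns b)))

  desnanot-jacobi-window : ∀ i j n →
    det R (suc (suc n)) (window i j (suc (suc n))) * det R n (window (suc i) (suc j) n)
      ≈ det R (suc n) (window (suc i) (suc j) (suc n)) * det R (suc n) (window i j (suc n))
        - det R (suc n) (window (suc i) j (suc n)) * det R (suc n) (window i (suc j) (suc n))
  desnanot-jacobi-window i j n = begin
    det R (suc (suc n)) A * det R n (window (suc i) (suc j) n)
      ≈⟨ *-congˡ (det-window-reindex n i j (suc i) (suc j) (suc ∘ inject₁) (suc ∘ inject₁) (interior i) (interior j)) ⟨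
    det R (suc (suc n)) A * det R n (λ a b → A (suc (inject₁ a)) (suc (inject₁ b)))
      ≈⟨ desnanot-jacobi n A ⟩
    det R (suc n) (λ a b → A (suc a) (suc b)) * det R (suc n) (λ a b → A (inject₁ a) (inject₁ b))
      - det R (suc n) (λ a b → A (suc a) (inject₁ b)) * det R (suc n) (λ a b → A (inject₁ a) (suc b))
      ≈⟨ +-cong (*-cong (det-window-reindex (suc n) i j (suc i) (suc j) suc suc (shift i) (shift j))
                        (det-window-reindex (suc n) i j i j inject₁ inject₁ (same i) (same j)))
                (-‿cong (*-cong (det-window-reindex (suc n) i j (suc i) j suc inject₁ (shift i) (same j))
                                (det-window-reindex (suc n) i j i (suc j) inject₁ suc (same i) (shift j)))) ⟩
    det R (suc n) (window (suc i) (suc j) (suc n)) * det R (suc n) (window i j (suc n))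
      - det R (suc n) (window (suc i) j (suc n)) * det R (suc n) (window i (suc j) (suc n)) ∎
    where
    A : Mat R (suc (suc n))
    A = window i j (suc (suc n))
    shift : ∀ k {m} (a : Fin m) → k +ℕ toℕ (suc a) ≡ suc k +ℕ toℕ a
    shift k a = +-suc k (toℕ a)
    same : ∀ k {m} (a : Fin m) → k +ℕ toℕ (inject₁ a) ≡ k +ℕ toℕ a
    same k a = ≡.cong (k +ℕ_) (toℕ-inject₁ a)
    interior : ∀ k {m} (a : Fin m) → k +ℕ toℕ (suc (inject₁ a)) ≡ suc k +ℕ toℕ a
    interior k a = ≡.trans (shift k (inject₁ a)) (same (suc k) a)

corollary3p4 : {c ℓ : Level} (R : CommutativeRing c ℓ) →
    let open CommutativeRing R in
    (N r p q : ℕ) → 1 ≤ p → 1 ≤ q → p +ℕ 1 ≤ r → r +ℕ q ≤ N →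
    (X Xm X0 Xp : Mat R N) → IsGaussDecomposition R X Xm X0 Xp →
    S R r (rect (p +ℕ 1) q) Xp * S R (r ∸ 1) (rect (p ∸ 1) q) Xp
      ≈ S R r (rect p q) Xp * S R (r ∸ 1) (rect p q) Xp
        - S R r (rect p (q ∸ 1)) Xp * S R (r ∸ 1) (rect p (q +ℕ 1)) Xp
corollary3p4 R N r p@(suc n) q@(suc k) _ _ p+1≤r r+q≤N X Xm X0 Xp (_ , _ , upper , _)
  with m≤n⇒∃[o]m+o≡n p+1≤r
... | o , ≡.refl = begin
    S R r (rect (p +ℕ 1) q) Xp * S R (r ∸ 1) (rect n q) Xp
      ≈⟨ *-cong (S-rect≈det-window o (suc p) q (o +ℕ q) r≡o+[p+1] p+1≡suc-p ≡.refl r≤N)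
                (S-rect≈det-window (suc o) n q (suc (o +ℕ q)) r∸1≡suc-o+n ≡.refl ≡.refl r∸1≤N) ⟩
    det R (suc p) (window o (o +ℕ q) (suc p)) * det R n (window (suc o) (suc (o +ℕ q)) n)
      ≈⟨ desnanot-jacobi-window o (o +ℕ q) n ⟩
    det R p (window (suc o) (suc (o +ℕ q)) p) * det R p (window o (o +ℕ q) p)
      - det R p (window (suc o) (o +ℕ q) p) * det R p (window o (suc (o +ℕ q)) p)
      ≈⟨ +-cong (*-cong (S-rect≈det-window (suc o) p q _ r≡suc-o+p ≡.refl ≡.refl r≤N)
                        (S-rect≈det-window o p q _ r∸1≡o+p ≡.refl ≡.refl r∸1≤N))
                (-‿cong (*-cong (S-rect≈det-window (suc o) p k _ r≡suc-o+p ≡.refl (≡.sym (+-suc o k)) r≤N)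
                                (S-rect≈det-window o p (q +ℕ 1) _ r∸1≡o+p ≡.refl o+[q+1]≡suc[o+q] r∸1≤N))) ⟨
    S R r (rect p q) Xp * S R (r ∸ 1) (rect p q) Xp
      - S R r (rect p k) Xp * S R (r ∸ 1) (rect p (q +ℕ 1)) Xp ∎
  where
  open CommutativeRing R
  open Determinant R
  open UnitriangularMinors R Xp upper
  open import Relation.Binary.Reasoning.Setoid setoid
  p+1≡suc-p : p +ℕ 1 ≡ suc p
  p+1≡suc-p = ℕ.+-comm p 1
  r≡o+[p+1] : r ≡ o +ℕ suc p
  r≡o+[p+1] = ≡.trans (ℕ.+-comm (p +ℕ 1) o) (≡.cong (o +ℕ_) p+1≡suc-p)
  r≡suc-o+p : r ≡ suc o +ℕ p
  r≡suc-o+p = ≡.trans r≡o+[p+1] (+-suc o p)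
  r∸1≡o+p : r ∸ 1 ≡ o +ℕ p
  r∸1≡o+p = ≡.cong (_∸ 1) r≡suc-o+p
  r∸1≡suc-o+n : r ∸ 1 ≡ suc o +ℕ n
  r∸1≡suc-o+n = ≡.trans r∸1≡o+p (+-suc o n)
  o+[q+1]≡suc[o+q] : o +ℕ (q +ℕ 1) ≡ suc (o +ℕ q)
  o+[q+1]≡suc[o+q] = ≡.trans (≡.cong (o +ℕ_) (ℕ.+-comm q 1)) (+-suc o q)
  r≤N : r ≤ N
  r≤N = ≤-trans (m≤m+n r q) r+q≤N
  r∸1≤N : r ∸ 1 ≤ N
  r∸1≤N = ≤-trans (m∸n≤m r 1) r≤N
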